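{- Let $G$ be a connected graph and $H=\mathcal{H}(G)$ its injective hull, with $G$ regarded as an isometric subgraph of $H$. For any $x,y,z\in V(G)$ and every $(x,y)$-path $P$ in $H$, there is an $(x,y)$-path $P^*$ in $G$ (all of whose vertices lie in $V(G)$) such that $d_H(z,P^*)\ge d_H(z,P)$.
   Context: Graphs are finite, simple, with shortest-path metric $d$; $d(z,P)=\min_{u\in P}d(z,u)$. A graph is Helly if every family of pairwise intersecting disks $D(v,r)=\{u:d(u,v)\le r\}$ has a common vertex. The injective hull $\mathcal{H}(G)$ is the unique minimal Helly graph containing $G$ as an isometric subgraph: its vertices are the functions $f:V(G)\to\mathbb{Z}_{\ge0}$ with $f(x)+f(y)\ge d_G(x,y)$ for all $x,y$ and for each $x$ some $y$ with equality, two functions adjacent iff $\max_x|f(x)-g(x)|=1$, and $G$ embeds via $z\mapsto d_G(z,\cdot)$. -}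

module Defs where

open import Data.Nat using (ℕ; zero; suc; _+_; _≤_; z≤n; ∣_-_∣)
open import Data.Nat.Properties using (≤-antisym; ≤-trans; +-identityʳ; n≤0⇒n≡0)
open import Data.Fin using (Fin)
open import Data.Vec using (Vec; lookup; tabulate)
open import Data.Vec.Properties using (lookup∘tabulate)
open import Data.List using (List; []; _∷_)
open import Data.List.Membership.Propositional using (_∈_)
open import Data.List.Relation.Unary.Unique.Propositional using (Unique)
open import Data.Product using (Σ; ∃; _×_; _,_; proj₁; proj₂)
open import Relation.Nullary using (¬_)
open import Relation.Binary.PropositionalEquality using (_≡_; refl; sym; trans; cong; subst)

data Walk {V : Set} (E : V → V → Set) : V → V → ℕ → Set where
  here : ∀ {a} → Walk E a a 0
  step : ∀ {a b c k} → E a b → Walk E b c k → Walk E a c (suc k)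

Dist : {V : Set} → (V → V → Set) → V → V → ℕ → Set
Dist E a b k = Walk E a b k × (∀ m → Walk E a b m → k ≤ m)

data Chain {V : Set} (E : V → V → Set) : V → V → List V → Set where
  single : ∀ {a} → Chain E a a (a ∷ [])
  cons   : ∀ {a b c vs} → E a b → Chain E b c vs → Chain E a c (a ∷ vs)

IsPath : {V : Set} → (V → V → Set) → V → V → List V → Set
IsPath E a b vs = Chain E a b vs × Unique vs

record Graph (n : ℕ) : Set₁ where
  field
    adj    : Fin n → Fin n → Set
    adj-sym    : ∀ {x y} → adj x y → adj y x
    adj-irrefl : ∀ {x} → ¬ adj x x
open Graph public

Connected : ∀ {n} → Graph n → Set
Connected G = ∀ x y → ∃ λ k → Walk (adj G) x y k

IsMetricOf : ∀ {n} → Graph n → (Fin n → Fin n → ℕ) → Set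
IsMetricOf G δ = ∀ x y → Dist (adj G) x y (δ x y)

-- Injective hull H(G): vertices are the functions f : V(G) → ℕ
-- (stored as vectors, so that equality of vertices is equality of
-- functions) with f x + f y ≥ d(x,y) for all x y and, for each x,
-- some y with equality.  The proof fields are irrelevant, so a hull
-- vertex is determined by its function.

record HullVertex {n : ℕ} (δ : Fin n → Fin n → ℕ) : Set where
  constructor hv
  field
    f      : Vec ℕ n
    .lower : ∀ x y → δ x y ≤ lookup f x + lookup f y
    .tight : ∀ x → ∃ λ y → lookup f x + lookup f y ≡ δ x y
open HullVertex public

HullAdj : ∀ {n} {δ : Fin n → Fin n → ℕ} → HullVertex δ → HullVertex δ → Set
HullAdj {n} u v =
  (∀ (x : Fin n) → ∣ lookup (f u) x - lookup (f v) x ∣ ≤ 1)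
  × (∃ λ (x : Fin n) → ∣ lookup (f u) x - lookup (f v) x ∣ ≡ 1)

DistH : ∀ {n} {δ : Fin n → Fin n → ℕ} → HullVertex δ → HullVertex δ → ℕ → Set
DistH = Dist HullAdj

module _ {V : Set} {E : V → V → Set} where
  walk-++ : ∀ {a b c k l} → Walk E a b k → Walk E b c l → Walk E a c (k + l)
  walk-++ here q = q
  walk-++ (step e p) q = step e (walk-++ p q)

  walk-snoc : ∀ {a b c k} → Walk E a b k → E b c → Walk E a c (suc k)
  walk-snoc here e = step e here
  walk-snoc (step e' p) e = step e' (walk-snoc p e)

  walk-rev : (∀ {x y} → E x y → E y x) → ∀ {a b k} → Walk E a b k → Walk E b a k
  walk-rev s here = here
  walk-rev s (step e p) = walk-snoc (walk-rev s p) (s e)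

module _ {n : ℕ} (G : Graph n) {δ : Fin n → Fin n → ℕ} (d : IsMetricOf G δ) where
  δ-tri : ∀ x y z → δ x y ≤ δ x z + δ z y
  δ-tri x y z = proj₂ (d x y) _ (walk-++ (proj₁ (d x z)) (proj₁ (d z y)))

  δ-sym : ∀ x y → δ x y ≡ δ y x
  δ-sym x y = ≤-antisym (proj₂ (d x y) _ (walk-rev (adj-sym G) (proj₁ (d y x))))
                        (proj₂ (d y x) _ (walk-rev (adj-sym G) (proj₁ (d x y))))

  δ-refl : ∀ x → δ x x ≡ 0
  δ-refl x = n≤0⇒n≡0 (proj₂ (d x x) 0 here)

  emb : Fin n → HullVertex δ
  emb z = hv (tabulate (δ z)) low tig
    where
    low : ∀ x y → δ x y ≤ lookup (tabulate (δ z)) x + lookup (tabulate (δ z)) y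
    low x y rewrite lookup∘tabulate (δ z) x | lookup∘tabulate (δ z) y | δ-sym z x = δ-tri x y z
    tig : ∀ x → ∃ λ y → lookup (tabulate (δ z)) x + lookup (tabulate (δ z)) y ≡ δ x y
    tig x rewrite lookup∘tabulate (δ z) x = z , trans (cong (δ z x +_) (trans (lookup∘tabulate (δ z) z) (δ-refl z)))
                                                     (trans (+-identityʳ _) (δ-sym z x))

module Submission where

-- A vertex u of the injective hull H is a function on V(G);
-- write u⟨x⟩ for its value at x.  Two facts about H carry the proof:
--   (1) d_H(z,u) = u⟨z⟩ for every z ∈ V(G) and u ∈ V(H).  "≥" holds because
--       adjacent hull vertices differ by at most 1 in every coordinate; "≤"
--       because a vertex with u⟨z⟩ = k+1 has a neighbour v with v⟨z⟩ = k,
--       obtained by tightening the feasible function min(u+1, d(z,·)+k).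
--   (2) Every hull vertex u has, for each z, a "partner" t ∈ V(G) with
--       u⟨z⟩ + u⟨t⟩ = d(z,t).
-- Let u be a vertex of P minimising u⟨z⟩ and put r = u⟨z⟩.  For consecutive
-- vertices u₁,u₂ of P with partners t₁,t₂ of z, every vertex of a geodesic
-- t₁ → t₂ of G lies at distance ≥ r from z.  Concatenating these geodesics
-- along P gives an (x,y)-walk of G inside {w : d(z,w) ≥ r}; erasing loops
-- makes it a path P*, and by (1) each w ∈ P* has d_H(z,w) = d(z,w) ≥ r = d_H(z,u).

open import Defs
open import Data.Nat using (ℕ; zero; suc; _+_; _≤_; _<_; z≤n; s≤s; _⊓_; ∣_-_∣; _≟_; _≤?_)
open import Data.Nat.Properties
open import Data.Nat.Tactic.RingSolver using (solve-∀)
open import Data.Fin using (Fin) renaming (_≟_ to _≟ᶠ_)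
open import Data.Fin.Properties using (any?; all?; ¬∀⟶∃¬)
open import Data.Vec using (lookup; tabulate)
open import Data.Vec.Properties using (lookup∘tabulate; tabulate∘lookup; tabulate-cong)
open import Data.Vec.Functional using (foldr; updateAt)
open import Data.Vec.Functional.Properties using (updateAt-updates; updateAt-minimal)
open import Data.List using (List; []; _∷_)
open import Data.List.Relation.Unary.All as All using (All; []; _∷_)
open import Data.List.Relation.Unary.All.Properties using (¬Any⇒All¬)
open import Data.List.Relation.Unary.Any using (here; there)
open import Data.List.Relation.Unary.AllPairs using ([]; _∷_)
open import Data.List.Membership.Propositional using (_∈_)
open import Data.List.Relation.Unary.Unique.Propositional using (Unique)
open import Data.List.Extrema.Nat using (argmin; argmin-sel; f[argmin]≤f[⊤]; f[argmin]≤f[xs])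
open import Data.Product using (Σ; ∃; _×_; _,_; proj₁; proj₂)
open import Data.Sum using ([_,_]′)
open import Data.Empty using (⊥-elim)
open import Function using (_∘_)
open import Relation.Nullary using (¬_; Dec; yes; no)
open import Relation.Nullary.Decidable using (recompute)
open import Relation.Binary.Definitions using (DecidableEquality)
open import Relation.Binary.PropositionalEquality

≤-⊓-+-⊓ : ∀ {t} p q r s → t ≤ p + r → t ≤ p + s → t ≤ q + r → t ≤ q + s →
          t ≤ p ⊓ q + r ⊓ s
≤-⊓-+-⊓ p q r s pr ps qr qs =
  subst (_ ≤_) (sym (+-distribʳ-⊓ (r ⊓ s) p q))
    (⊓-glb (subst (_ ≤_) (sym (+-distribˡ-⊓ p r s)) (⊓-glb pr ps))
           (subst (_ ≤_) (sym (+-distribˡ-⊓ q r s)) (⊓-glb qr qs)))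

∣-∣≤1 : ∀ a b → a ≤ suc b → b ≤ suc a → ∣ a - b ∣ ≤ 1
∣-∣≤1 zero    zero          _       _       = z≤n
∣-∣≤1 zero    (suc zero)    _       _       = ≤-refl
∣-∣≤1 zero    (suc (suc b)) _       (s≤s ())
∣-∣≤1 (suc zero)    zero    _       _       = ≤-refl
∣-∣≤1 (suc (suc a)) zero    (s≤s ()) _
∣-∣≤1 (suc a) (suc b)       (s≤s p) (s≤s q) = ∣-∣≤1 a b p q

∣suc-∣≡1 : ∀ k → ∣ suc k - k ∣ ≡ 1
∣suc-∣≡1 zero    = refl
∣suc-∣≡1 (suc k) = ∣suc-∣≡1 k

-- Finite sums, used as a termination measure

total : ∀ {m} → (Fin m → ℕ) → ℕ
total = foldr _+_ 0

total-mono : ∀ {m} (g h : Fin m → ℕ) → (∀ x → h x ≤ g x) → total h ≤ total g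
total-mono {zero}  g h le = z≤n
total-mono {suc m} g h le = +-mono-≤ (le Fin.zero) (total-mono (g ∘ Fin.suc) (h ∘ Fin.suc) (le ∘ Fin.suc))

total-strict : ∀ {m} (g h : Fin m → ℕ) a → (∀ x → h x ≤ g x) → h a < g a → total h < total g
total-strict {suc m} g h Fin.zero le lt =
  +-mono-<-≤ lt (total-mono (g ∘ Fin.suc) (h ∘ Fin.suc) (le ∘ Fin.suc))
total-strict {suc m} g h (Fin.suc a) le lt =
  +-mono-≤-< (le Fin.zero) (total-strict (g ∘ Fin.suc) (h ∘ Fin.suc) a (le ∘ Fin.suc) lt)

dist-unique : ∀ {V : Set} {E : V → V → Set} {a b k l} → Dist E a b k → Dist E a b l → k ≡ l
dist-unique (p , p-min) (q , q-min) = ≤-antisym (p-min _ q) (q-min _ p)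

chain-++ : ∀ {V : Set} {E : V → V → Set} {P : V → Set} {a b c vs ws} →
           Chain E a b vs → All P vs → Chain E b c ws → All P ws →
           Σ (List V) λ us → Chain E a c us × All P us
chain-++ single      _        q qs = _ , q , qs
chain-++ (cons e p) (pa ∷ ps) q qs with chain-++ p ps q qs
... | us , c , as = _ , cons e c , pa ∷ as

chain-head : ∀ {V : Set} {E : V → V → Set} {P : V → Set} {a b vs} → Chain E a b vs → All P vs → P a
chain-head single     (pa ∷ _) = pa
chain-head (cons _ _) (pa ∷ _) = pa

module LoopErasure {A : Set} (_≟ᴬ_ : DecidableEquality A) {E : A → A → Set} {P : A → Set} where
  open import Data.List.Membership.DecPropositional _≟ᴬ_ using (_∈?_)

  suffix : ∀ {a b c us} → Chain E b c us → Unique us → All P us → a ∈ us →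
           Σ (List A) λ ws → IsPath E a c ws × All P ws
  suffix single       un as (here refl) = _ , (single , un) , as
  suffix (cons e ch)  un as (here refl) = _ , (cons e ch , un) , as
  suffix (cons e ch) (_ ∷ un) (_ ∷ as) (there m) = suffix ch un as m

  loop-erase : ∀ {a c vs} → Chain E a c vs → All P vs →
               Σ (List A) λ ws → IsPath E a c ws × All P ws
  loop-erase {a} single      (pa ∷ []) = (a ∷ []) , (single , [] ∷ []) , pa ∷ []
  loop-erase {a} (cons e ch) (pa ∷ ps) with loop-erase ch ps
  ... | us , (c , un) , as with a ∈? us
  ...   | yes a∈us = suffix c un as a∈us
  ...   | no  a∉us = (a ∷ us) , (cons e c , ¬Any⇒All¬ us a∉us ∷ un) , pa ∷ as
open LoopErasure using (loop-erase)

minimiser : ∀ {A : Set} (h : A → ℕ) a as →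
            ∃ λ m → m ∈ (a ∷ as) × All (λ v → h m ≤ h v) (a ∷ as)
minimiser h a as =
  argmin h a as , [ here , there ]′ (argmin-sel h a as) , f[argmin]≤f[⊤] {f = h} a as ∷ f[argmin]≤f[xs] {f = h} a as

module Hull {n : ℕ} (G : Graph n) {δ : Fin n → Fin n → ℕ} (d : IsMetricOf G δ) where

  private
    tri : ∀ x y w → δ x y ≤ δ x w + δ w y
    tri = δ-tri G d
    δsym : ∀ x y → δ x y ≡ δ y x
    δsym = δ-sym G d
    δ-zero : ∀ x → δ x x ≡ 0
    δ-zero = δ-refl G d

  coord : HullVertex δ → Fin n → ℕ
  coord u x = lookup (f u) x

  Feasible : (Fin n → ℕ) → Set
  Feasible g = ∀ a b → δ a b ≤ g a + g b

  TightAt : (Fin n → ℕ) → Fin n → Set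
  TightAt g a = ∃ λ b → g a + g b ≡ δ a b

  tightAt? : ∀ g a → Dec (TightAt g a)
  tightAt? g a = any? (λ b → g a + g b ≟ δ a b)

  -- The defining properties of a hull vertex are stored irrelevantly; being
  -- decidable, they can be recovered.
  coord-feasible : ∀ u → Feasible (coord u)
  coord-feasible (hv v l t) a b = recompute (δ a b ≤? lookup v a + lookup v b) (l a b)

  coord-tight : ∀ u a → TightAt (coord u) a
  coord-tight (hv v l t) a = recompute (tightAt? (lookup v) a) (t a)

  hull-ext : ∀ (u v : HullVertex δ) → f u ≡ f v → u ≡ v
  hull-ext (hv _ _ _) (hv _ _ _) refl = refl

  toHull : (g : Fin n → ℕ) → Feasible g → (∀ a → TightAt g a) → HullVertex δ
  toHull g fe ti = hv (tabulate g) feasible tight-everywhere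
    where
    feasible : ∀ x y → δ x y ≤ lookup (tabulate g) x + lookup (tabulate g) y
    feasible x y rewrite lookup∘tabulate g x | lookup∘tabulate g y = fe x y
    tight-everywhere : ∀ x → TightAt (lookup (tabulate g)) x
    tight-everywhere x rewrite lookup∘tabulate g x with ti x
    ... | y , e = y , trans (cong (g x +_) (lookup∘tabulate g y)) e

  coord-toHull : ∀ g fe ti x → coord (toHull g fe ti) x ≡ g x
  coord-toHull g _ _ x = lookup∘tabulate g x

  coord-emb : ∀ a x → coord (emb G d a) x ≡ δ a x
  coord-emb a x = lookup∘tabulate (δ a) x

  emb-partner : ∀ a z → coord (emb G d a) z + coord (emb G d a) a ≡ δ z a
  emb-partner a z = begin
    coord (emb G d a) z + coord (emb G d a) a ≡⟨ cong₂ _+_ (coord-emb a z) (coord-emb a a) ⟩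
    δ a z + δ a a                             ≡⟨ cong (δ a z +_) (δ-zero a) ⟩
    δ a z + 0                                 ≡⟨ +-identityʳ _ ⟩
    δ a z                                     ≡⟨ δsym a z ⟩
    δ z a                                     ∎
    where open ≡-Reasoning

  coord-lipschitz : ∀ u x z → coord u x ≤ δ x z + coord u z
  coord-lipschitz u x z with coord-tight u x
  ... | w , e = +-cancelʳ-≤ (coord u w) _ _ (begin
    coord u x + coord u w         ≡⟨ e ⟩
    δ x w                         ≤⟨ tri x w z ⟩
    δ x z + δ z w                 ≤⟨ +-monoʳ-≤ (δ x z) (coord-feasible u z w) ⟩
    δ x z + (coord u z + coord u w) ≡⟨ sym (+-assoc (δ x z) _ _) ⟩
    δ x z + coord u z + coord u w ∎)
    where open ≤-Reasoning

  coord≡0⇒emb : ∀ z u → coord u z ≡ 0 → emb G d z ≡ u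
  coord≡0⇒emb z u uz = hull-ext _ _ (trans (tabulate-cong same) (tabulate∘lookup (f u)))
    where
    same : ∀ x → δ z x ≡ coord u x
    same x = ≤-antisym
      (subst (λ k → δ z x ≤ k + coord u x) uz (coord-feasible u z x))
      (subst (coord u x ≤_) (trans (cong (δ x z +_) uz) (trans (+-identityʳ _) (δsym x z)))
             (coord-lipschitz u x z))

  -- A coordinate that is not tight is positive (0 would be tight with itself).
  untight-positive : ∀ g a → ¬ TightAt g a → ∃ λ k → g a ≡ suc k
  untight-positive g a nt = by-value (g a) refl
    where
    by-value : ∀ m → g a ≡ m → ∃ λ k → g a ≡ suc k
    by-value zero    ga = ⊥-elim (nt (a , trans (cong₂ _+_ ga ga) (sym (δ-zero a))))
    by-value (suc k) ga = k , ga

  untight-slack : ∀ g a k → g a ≡ suc k → Feasible g → ¬ TightAt g a → ∀ b → δ a b ≤ k + g b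
  untight-slack g a k ga fe nt b =
    ≤-pred (≤∧≢⇒< (subst (λ m → δ a b ≤ m + g b) ga (fe a b))
                  (λ e → nt (b , sym (trans e (cong (_+ g b) (sym ga))))))

  lowerAt : (Fin n → ℕ) → Fin n → ℕ → Fin n → ℕ
  lowerAt g a k = updateAt g a (λ _ → k)

  lowerAt-≤ : ∀ g a k → g a ≡ suc k → ∀ x → lowerAt g a k x ≤ g x
  lowerAt-≤ g a k ga x with x ≟ᶠ a
  ... | yes refl = subst₂ _≤_ (sym (updateAt-updates x g)) (sym ga) (n≤1+n k)
  ... | no  x≢a  = ≤-reflexive (updateAt-minimal x a g x≢a)

  lowerAt-feasible : ∀ g a k → g a ≡ suc k → Feasible g → ¬ TightAt g a → Feasible (lowerAt g a k)
  lowerAt-feasible g a k ga fe nt x y with x ≟ᶠ a | y ≟ᶠ a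
  ... | yes refl | yes refl = subst (_≤ _) (sym (δ-zero x)) z≤n
  ... | yes refl | no y≢a =
    subst₂ (λ p q → δ x y ≤ p + q) (sym (updateAt-updates x g)) (sym (updateAt-minimal y x g y≢a))
      (untight-slack g x k ga fe nt y)
  ... | no x≢a | yes refl =
    subst₂ (λ p q → δ x y ≤ p + q) (sym (updateAt-minimal x y g x≢a)) (sym (updateAt-updates y g))
      (subst₂ _≤_ (δsym y x) (+-comm k (g x)) (untight-slack g y k ga fe nt x))
  ... | no x≢a | no y≢a =
    subst₂ (λ p q → δ x y ≤ p + q) (sym (updateAt-minimal x a g x≢a)) (sym (updateAt-minimal y a g y≢a))
      (fe x y)

  -- Lower untight coordinates one unit at a time; the total decreases,
  -- so fuel > total g suffices for termination.
  tighten : ∀ fuel g → total g < fuel → Feasible g →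
            Σ (Fin n → ℕ) λ h → (∀ x → h x ≤ g x) × Feasible h × (∀ a → TightAt h a)
  tighten (suc fuel) g lt fe with all? (tightAt? g)
  ... | yes ti = g , (λ _ → ≤-refl) , fe , ti
  ... | no nt with ¬∀⟶∃¬ n _ (tightAt? g) nt
  ... | a , na with untight-positive g a na
  ... | k , ga with tighten fuel (lowerAt g a k) decreased (lowerAt-feasible g a k ga fe na)
    where
    at-a : lowerAt g a k a < g a
    at-a = subst₂ _<_ (sym (updateAt-updates a g)) (sym ga) ≤-refl
    decreased : total (lowerAt g a k) < fuel
    decreased = ≤-trans (total-strict g _ a (lowerAt-≤ g a k ga) at-a) (≤-pred lt)
  ... | h , le , fh , th = h , (λ x → ≤-trans (le x) (lowerAt-≤ g a k ga x)) , fh , th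

  hull-adj-sym : ∀ u v → HullAdj u v → HullAdj v u
  hull-adj-sym u v (close , x , e) =
    (λ y → subst (_≤ 1) (∣-∣-comm (coord u y) (coord v y)) (close y)) ,
    x , trans (∣-∣-comm (coord v x) (coord u x)) e

  adj-coord : ∀ u v → HullAdj u v → ∀ x → coord u x ≤ suc (coord v x)
  adj-coord u v (close , _) x = begin
    coord u x                           ≤⟨ m≤n+∣m-n∣ (coord u x) (coord v x) ⟩
    coord v x + ∣ coord u x - coord v x ∣ ≤⟨ +-monoʳ-≤ (coord v x) (close x) ⟩
    coord v x + 1                       ≡⟨ +-comm (coord v x) 1 ⟩
    suc (coord v x)                     ∎
    where open ≤-Reasoning

  adjacent-if-close : ∀ u v → (∀ x → coord u x ≤ suc (coord v x)) → (∀ x → coord v x ≤ suc (coord u x)) →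
                      ∀ z k → coord u z ≡ suc k → coord v z ≡ k → HullAdj u v
  adjacent-if-close u v uv vu z k uz vz =
    (λ x → ∣-∣≤1 (coord u x) (coord v x) (uv x) (vu x)) , z , trans (cong₂ ∣_-_∣ uz vz) (∣suc-∣≡1 k)

  -- A feasible h below u+1 is above u-1 (compare through the partner of x in u).
  below-successor⇒above-predecessor : ∀ u h → Feasible h → (∀ x → h x ≤ suc (coord u x)) →
                                       ∀ x → coord u x ≤ suc (h x)
  below-successor⇒above-predecessor u h fh hu x with coord-tight u x
  ... | w , e = +-cancelʳ-≤ (coord u w) _ _ (begin
    coord u x + coord u w   ≡⟨ e ⟩
    δ x w                   ≤⟨ fh x w ⟩
    h x + h w               ≤⟨ +-monoʳ-≤ (h x) (hu w) ⟩
    h x + suc (coord u w)   ≡⟨ +-suc (h x) (coord u w) ⟩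
    suc (h x) + coord u w   ∎)
    where open ≤-Reasoning

  module Toward (z : Fin n) where

    -- Coordinates change by at most 1 along each edge, so u⟨z⟩ ≤ d_H(z,u).
    walk-coord : ∀ {a b m} → Walk HullAdj a b m → coord b z ≤ coord a z + m
    walk-coord {a} here = m≤m+n (coord a z) 0
    walk-coord {a} {b} (step {b = c} {k = k} e p) = begin
      coord b z           ≤⟨ walk-coord p ⟩
      coord c z + k       ≤⟨ +-monoˡ-≤ k (adj-coord c a (hull-adj-sym a c e) z) ⟩
      suc (coord a z) + k ≡⟨ sym (+-suc (coord a z) k) ⟩
      coord a z + suc k   ∎
      where open ≤-Reasoning

    -- The candidate min(u+1, δ(z,·)+k) for a neighbour of u one step closer to z.
    cap : HullVertex δ → ℕ → Fin n → ℕ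
    cap u k x = suc (coord u x) ⊓ (δ z x + k)

    cap-feasible : ∀ u k → coord u z ≡ suc k → Feasible (cap u k)
    cap-feasible u k uz a b =
      ≤-⊓-+-⊓ (suc (coord u a)) (δ z a + k) (suc (coord u b)) (δ z b + k)
        (≤-trans (coord-feasible u a b) (+-mono-≤ (n≤1+n _) (n≤1+n _)))
        (via-z a b)
        (subst₂ _≤_ (δsym b a) (+-comm _ (δ z a + k)) (via-z b a))
        (≤-trans (tri a b z) (+-mono-≤ (≤-trans (≤-reflexive (δsym a z)) (m≤m+n _ k)) (m≤m+n _ k)))
      where
      via-z : ∀ a b → δ a b ≤ suc (coord u a) + (δ z b + k)
      via-z a b = begin
        δ a b                           ≤⟨ tri a b z ⟩
        δ a z + δ z b                   ≤⟨ +-monoˡ-≤ (δ z b) (coord-feasible u a z) ⟩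
        coord u a + coord u z + δ z b   ≡⟨ cong (λ m → coord u a + m + δ z b) uz ⟩
        coord u a + suc k + δ z b       ≡⟨ regroup (coord u a) k (δ z b) ⟩
        suc (coord u a) + (δ z b + k)   ∎
        where
        open ≤-Reasoning
        regroup : ∀ p k q → p + suc k + q ≡ suc p + (q + k)
        regroup = solve-∀

    step-toward : ∀ u k → coord u z ≡ suc k → Σ (HullVertex δ) λ v → HullAdj u v × coord v z ≡ k
    step-toward u k uz with tighten (suc (total (cap u k))) (cap u k) (n<1+n _) (cap-feasible u k uz)
    ... | h , h≤cap , fh , th = v , adjacent-if-close u v u≤v+1 v≤u+1 z k uz vz , vz
      where
      v = toHull h fh th
      h≤u+1 : ∀ x → h x ≤ suc (coord u x)
      h≤u+1 x = ≤-trans (h≤cap x) (m⊓n≤m _ _)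
      u≤v+1 : ∀ x → coord u x ≤ suc (coord v x)
      u≤v+1 x = subst (λ m → coord u x ≤ suc m) (sym (coord-toHull h fh th x))
                      (below-successor⇒above-predecessor u h fh h≤u+1 x)
      v≤u+1 : ∀ x → coord v x ≤ suc (coord u x)
      v≤u+1 x = subst (_≤ _) (sym (coord-toHull h fh th x)) (h≤u+1 x)
      vz : coord v z ≡ k
      vz = ≤-antisym
        (subst (_≤ k) (sym (coord-toHull h fh th z))
          (≤-trans (h≤cap z) (≤-trans (m⊓n≤n _ _) (≤-reflexive (cong (_+ k) (δ-zero z))))))
        (≤-pred (subst (_≤ suc (coord v z)) uz (u≤v+1 z)))

    walk-from-emb : ∀ k u → coord u z ≡ k → Walk HullAdj (emb G d z) u k
    walk-from-emb zero    u uz = subst (λ v → Walk HullAdj (emb G d z) v 0) (coord≡0⇒emb z u uz) here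
    walk-from-emb (suc k) u uz with step-toward u k uz
    ... | v , uv , vz = walk-snoc (walk-from-emb k v vz) (hull-adj-sym u v uv)

    hull-distance : ∀ u → DistH (emb G d z) u (coord u z)
    hull-distance u = walk-from-emb _ u refl , λ m p →
      subst (λ c → coord u z ≤ c + m) (trans (coord-emb z z) (δ-zero z)) (walk-coord p)

  -- Lifting hull paths to G inside a level set {w : r ≤ δ(z,w)}.

  module Level (z : Fin n) (r : ℕ) where

    Above : Fin n → Set
    Above w = r ≤ δ z w

    OnGeodesic : Fin n → Fin n → Fin n → Set
    OnGeodesic t s q = δ t q + δ q s ≤ δ t s

    geodesic-chain : ∀ t s → Σ (List (Fin n)) λ vs → Chain (adj G) t s vs × All (OnGeodesic t s) vs
    geodesic-chain t s = along (proj₁ (d t s)) (≤-reflexive (cong (_+ δ t s) (δ-zero t)))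
      where
      -- invariant: the remaining walk from the current vertex q has length m
      -- and δ(t,q) + m ≤ δ(t,s)
      along : ∀ {q m} → Walk (adj G) q s m → δ t q + m ≤ δ t s →
              Σ (List (Fin n)) λ vs → Chain (adj G) q s vs × All (OnGeodesic t s) vs
      along {q} here bound =
        (q ∷ []) , single , ≤-trans (+-monoʳ-≤ (δ t q) (≤-reflexive (δ-zero q))) bound ∷ []
      along {q} {suc m} (step {b = q′} e p) bound with along p bound′
        where
        bound′ : δ t q′ + m ≤ δ t s
        bound′ = ≤-trans (+-monoˡ-≤ m (≤-trans (tri t q′ q) (+-monoʳ-≤ (δ t q) (proj₂ (d q q′) 1 (step e here)))))
                 (≤-trans (≤-reflexive (+-assoc (δ t q) 1 m)) bound)
      ... | vs , c , as =
        (q ∷ vs) , cons e c , ≤-trans (+-monoʳ-≤ (δ t q) (proj₂ (d q s) _ (step e p))) bound ∷ as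

    geodesic-above : ∀ t s q → δ t s + (r + r) ≤ δ z t + δ z s + 1 → OnGeodesic t s q → Above q
    geodesic-above t s q far geo = ≮⇒≥ below-impossible
      where
      a = δ z q
      via-q : δ z t + δ z s ≤ (a + a) + δ t s
      via-q = begin
        δ z t + δ z s                     ≤⟨ +-mono-≤ (tri z t q) (tri z s q) ⟩
        (a + δ q t) + (a + δ q s)         ≡⟨ cong (λ m → (a + m) + (a + δ q s)) (δsym q t) ⟩
        (a + δ t q) + (a + δ q s)         ≡⟨ regroup a (δ t q) (δ q s) ⟩
        (a + a) + (δ t q + δ q s)         ≤⟨ +-monoʳ-≤ (a + a) geo ⟩
        (a + a) + δ t s                   ∎
        where
        open ≤-Reasoning
        regroup : ∀ a b c → (a + b) + (a + c) ≡ (a + a) + (b + c)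
        regroup = solve-∀
      below-impossible : ¬ (a < r)
      below-impossible a<r = 1+n≰n (begin
        suc (suc ((a + a) + δ t s))     ≡⟨ regroup a (δ t s) ⟩
        δ t s + (suc a + suc a)         ≤⟨ +-monoʳ-≤ (δ t s) (+-mono-≤ a<r a<r) ⟩
        δ t s + (r + r)                 ≤⟨ far ⟩
        δ z t + δ z s + 1               ≤⟨ +-monoˡ-≤ 1 via-q ⟩
        (a + a) + δ t s + 1             ≡⟨ +-comm _ 1 ⟩
        suc ((a + a) + δ t s)           ∎)
        where
        open ≤-Reasoning
        regroup : ∀ a d → suc (suc ((a + a) + d)) ≡ d + (suc a + suc a)
        regroup = solve-∀

    geodesic-in-level : ∀ t s → δ t s + (r + r) ≤ δ z t + δ z s + 1 →
                        Σ (List (Fin n)) λ vs → Chain (adj G) t s vs × All Above vs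
    geodesic-in-level t s far with geodesic-chain t s
    ... | vs , c , geo = vs , c , All.map (λ {q} → geodesic-above t s q far) geo

    partners-far : ∀ u v t s → coord u s ≤ suc (coord v s) →
                   coord u z + coord u t ≡ δ z t → coord v z + coord v s ≡ δ z s →
                   r ≤ coord u z → r ≤ coord v z → δ t s + (r + r) ≤ δ z t + δ z s + 1
    partners-far u v t s us et es ru rv = begin
      δ t s + (r + r)                     ≤⟨ +-mono-≤ (≤-trans (coord-feasible u t s) (+-monoʳ-≤ (coord u t) us))
                                                      (+-mono-≤ ru rv) ⟩
      (ut + suc vs) + (uz + vz)           ≡⟨ regroup ut vs uz vz ⟩
      (uz + ut) + (vz + vs) + 1           ≡⟨ cong₂ (λ p q → p + q + 1) et es ⟩
      δ z t + δ z s + 1                   ∎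
      where
      open ≤-Reasoning
      ut = coord u t
      vs = coord v s
      uz = coord u z
      vz = coord v z
      regroup : ∀ a b c e → (a + suc b) + (c + e) ≡ (c + a) + (e + b) + 1
      regroup = solve-∀

    lift-chain : ∀ y {u} vs → Chain HullAdj u (emb G d y) vs → All (λ w → r ≤ coord w z) vs →
                 ∀ t → coord u z + coord u t ≡ δ z t →
                 Σ (List (Fin n)) λ ws → Chain (adj G) t y ws × All Above ws
    lift-chain y {u} _ single (ru ∷ []) t et =
      geodesic-in-level t y (partners-far u u t y (n≤1+n _) et (emb-partner y z) ru ru)
    lift-chain y {u} _ (cons {b = u′} e c) (ru ∷ rs) t et with coord-tight u′ z
    ... | s , es with geodesic-in-level t s (partners-far u u′ t s (adj-coord u u′ e s) et es ru (chain-head c rs))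
                    | lift-chain y _ c rs s es
    ... | vs , c₁ , a₁ | ws , c₂ , a₂ = chain-++ c₁ a₁ c₂ a₂

corollary1 : ∀ {n : ℕ} (G : Graph n) → Connected G →
    (δ : Fin n → Fin n → ℕ) (d : IsMetricOf G δ) →
    ∀ (x y z : Fin n) (P : List (HullVertex δ)) →
    IsPath HullAdj (emb G d x) (emb G d y) P →
    ∃ λ (Pstar : List (Fin n)) →
    IsPath (adj G) x y Pstar
    × (∃ λ u → u ∈ P ×
    (∀ w → w ∈ Pstar → ∀ ku kw →
    DistH (emb G d z) u ku → DistH (emb G d z) (emb G d w) kw → ku ≤ kw))
corollary1 G _ δ d x y z [] (() , _)
corollary1 G _ δ d x y z (p ∷ ps) (walk , _)
  with minimiser (λ w → coord w z) p ps
  where open Hull G d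
... | u , u∈P , u-min
  with Level.lift-chain z (coord u z) y _ walk u-min x (emb-partner x z)
  where open Hull G d
... | ws , chain , above
  with loop-erase _≟ᶠ_ chain above
... | Pstar , path , above* = Pstar , path , u , u∈P , closer
  where
  open Hull G d
  closer : ∀ w → w ∈ Pstar → ∀ ku kw → DistH (emb G d z) u ku → DistH (emb G d z) (emb G d w) kw → ku ≤ kw
  closer w w∈P* ku kw du dw = begin
    ku                      ≡⟨ dist-unique du (Toward.hull-distance z u) ⟩
    coord u z               ≤⟨ All.lookup above* w∈P* ⟩
    δ z w                   ≡⟨ sym (trans (coord-emb w z) (δ-sym G d w z)) ⟩
    coord (emb G d w) z     ≡⟨ dist-unique (Toward.hull-distance z (emb G d w)) dw ⟩
    kw                      ∎
    where open ≤-Reasoning
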